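{- Every meta-thin association scheme whose thin residue has index at most three is schurian and separable.
   Context: A coherent configuration is a pair $(\Omega,S)$ where $\Omega$ is a finite set and $S$ is a partition of $\Omega\times\Omega$ (basis relations) such that $1_\Omega$ is a union of basis relations, $s^*=\{(\beta,\alpha):(\alpha,\beta)\in s\}\in S$ for all $s\in S$, and for all $r,s,t\in S$ the number $c^t_{rs}=|\alpha r\cap\beta s^*|$ is independent of $(\alpha,\beta)\in t$, where $\alpha r=\{\beta:(\alpha,\beta)\in r\}$. An association scheme is a coherent configuration with $1_\Omega\in S$. The valency of $s\in S$ is $n_s=|\alpha s|$ ($\alpha\in\Omega$ arbitrary). For $r,s\in S$, the complex product $rs$ is the set of basis relations contained in $\{(\alpha,\beta):(\alpha,\gamma)\in r,(\gamma,\beta)\in s\text{ for some }\gamma\}$, extended to subsets $X,Y\subseteq S$ by $XY=\bigcup_{r\in X,s\in Y}rs$. A nonempty $T\subseteq S$ is closed if $TT^*\subseteq T$. The thin radical is $\{s\in S:n_s=1\}$; the thin residue is the smallest closed subset containing $ss^*$ for all $s\in S$. The scheme is meta-thin if its thin residue is contained in its thin radical. The index of a closed subset $T$ is $|\Omega|/n_T$ with $n_T=\sum_{t\in T}n_t$ (the number of classes of the equivalence relation $\bigcup T$). The scheme is schurian if $S$ is the set of orbits on $\Omega\times\Omega$ of some permutation group on $\Omega$; it is separable if for every coherent configuration $(\Omega',S')$ and every bijection $\varphi:S\to S'$ with $c^t_{rs}=c^{\varphi(t)}_{\varphi(r)\varphi(s)}$ for all $r,s,t$, there is a bijection $f:\Omega\to\Omega'$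 with $\{(\alpha^f,\beta^f):(\alpha,\beta)\in s\}=\varphi(s)$ for all $s\in S$. -}

module Defs where

open import Data.Nat using (ℕ; zero; suc; _+_; _*_; _≤_)
open import Data.Bool using (Bool; true; false; if_then_else_)
open import Data.Fin using (Fin; zero; suc; _≟_)
open import Data.Fin.Subset using (Subset; _∈_; _⊆_)
open import Data.Product using (Σ; ∃; ∃-syntax; _×_; _,_)
open import Relation.Nullary.Decidable using (⌊_⌋)
open import Relation.Binary.PropositionalEquality using (_≡_)
open import Function.Bundles using (_↔_; _⇔_; Inverse)
open import Data.Fin.Permutation using (Permutation′; _⟨$⟩ʳ_; _∘ₚ_; flip)

count : ∀ {n} → (Fin n → Bool) → ℕ
count {zero}  p = 0
count {suc n} p = (if p zero then 1 else 0) + count (λ i → p (suc i))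

sumFin : ∀ {m} → (Fin m → ℕ) → ℕ
sumFin {zero}  f = 0
sumFin {suc m} f = f zero + sumFin (λ i → f (suc i))

-- A coherent configuration on Ω = Fin n with basis relations indexed by Fin m.
-- rel α β is the (unique) basis relation containing (α , β).
record CoherentConfiguration (n m : ℕ) : Set where
  field
    rel : Fin n → Fin n → Fin m
    nonempty : ∀ (s : Fin m) → ∃[ α ] ∃[ β ] rel α β ≡ s
    -- 1_Ω is a union of basis relations
    diagUnion : ∀ α β γ → rel α α ≡ rel β γ → β ≡ γ
    transposeClosed : ∀ (s : Fin m) → ∃[ s' ] (∀ α β → rel α β ≡ s → rel β α ≡ s')
                                              × (∀ α β → rel β α ≡ s' → rel α β ≡ s)

  -- |α r ∩ β s*| = #{γ : (α,γ) ∈ r, (γ,β) ∈ s}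
  inter : Fin m → Fin m → Fin n → Fin n → ℕ
  inter r s α β = count (λ γ → ⌊ rel α γ ≟ r ⌋ Data.Bool.∧ ⌊ rel γ β ≟ s ⌋)

  field
    regular : ∀ r s α β α' β' → rel α β ≡ rel α' β' → inter r s α β ≡ inter r s α' β'

  -- valency of s, computed at the point α (independent of α)
  valencyAt : Fin n → Fin m → ℕ
  valencyAt α s = count (λ β → ⌊ rel α β ≟ s ⌋)

open CoherentConfiguration public

record AssociationScheme (n m : ℕ) : Set where
  field
    cc : CoherentConfiguration n m
    diagBasis : ∀ α β → rel cc α α ≡ rel cc β β

open AssociationScheme public

module _ {n m : ℕ} (X : CoherentConfiguration n m) where

  -- t ∈ r s*  (complex product of r with the transpose of s):
  -- some (α,β) ∈ t and γ with (α,γ) ∈ r, (γ,β) ∈ s*, i.e. (β,γ) ∈ s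
  InProdStar : Fin m → Fin m → Fin m → Set
  InProdStar r s t = ∃[ α ] ∃[ β ] ∃[ γ ] (rel X α β ≡ t × rel X α γ ≡ r × rel X β γ ≡ s)

  Closed : Subset m → Set
  Closed T = (∃[ t ] t ∈ T) × (∀ r s t → r ∈ T → s ∈ T → InProdStar r s t → t ∈ T)

  ContainsAllSS* : Subset m → Set
  ContainsAllSS* T = ∀ s t → InProdStar s s t → t ∈ T

  IsThinResidue : Subset m → Set
  IsThinResidue R = Closed R × ContainsAllSS* R
                    × (∀ T → Closed T → ContainsAllSS* T → R ⊆ T)

  Thin : Fin m → Set
  Thin s = ∀ α → valencyAt X α s ≡ 1

  nT : Subset m → Fin n → ℕ
  nT T α = sumFin (λ t → if Data.Vec.lookup T t then valencyAt X α t else 0)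
    where import Data.Vec

  -- index of T is at most 3:  |Ω| / n_T ≤ 3, i.e. |Ω| ≤ 3 · n_T
  IndexAtMost3 : Subset m → Set
  IndexAtMost3 T = ∀ α → n ≤ 3 * nT T α

module _ {n m : ℕ} (A : AssociationScheme n m) where

  MetaThin : Set
  MetaThin = ∀ R → IsThinResidue (cc A) R → ∀ t → t ∈ R → Thin (cc A) t

  ThinResidueIndexAtMost3 : Set
  ThinResidueIndexAtMost3 = ∀ R → IsThinResidue (cc A) R → IndexAtMost3 (cc A) R

record IsPermGroup {n : ℕ} (G : Permutation′ n → Set) : Set where
  field
    hasId   : ∃[ e ] (G e × (∀ α → e ⟨$⟩ʳ α ≡ α))
    compCl  : ∀ g h → G g → G h → G (g ∘ₚ h)
    invCl   : ∀ g → G g → G (flip g)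

Schurian : ∀ {n m} → CoherentConfiguration n m → Set₁
Schurian {n} X = Σ (Permutation′ n → Set) λ G → IsPermGroup G ×
  (∀ α β α' β' → (rel X α β ≡ rel X α' β')
      ⇔ (∃[ g ] (G g × g ⟨$⟩ʳ α ≡ α' × g ⟨$⟩ʳ β ≡ β')))

IsAlgIso : ∀ {n m n' m'} → CoherentConfiguration n m → CoherentConfiguration n' m'
           → (Fin m ↔ Fin m') → Set
IsAlgIso X X' φ = ∀ r s α β α' β' → rel X' α' β' ≡ Inverse.to φ (rel X α β)
  → inter X r s α β ≡ inter X' (Inverse.to φ r) (Inverse.to φ s) α' β'

Separable : ∀ {n m} → CoherentConfiguration n m → Set
Separable {n} {m} X = ∀ n' m' (X' : CoherentConfiguration n' m') (φ : Fin m ↔ Fin m')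
  → IsAlgIso X X' φ
  → Σ (Fin n ↔ Fin n') λ f → ∀ α β → rel X' (Inverse.to f α) (Inverse.to f β)
                     ≡ Inverse.to φ (rel X α β)

-- Let R be the thin residue.  Meta-thinness makes every relation in R thin, so α ~ β  :⇔
-- r(α,β) ∈ R is an equivalence relation in which a point sees each point of its class through
-- a different relation; the index bound says that there are at most three classes.
-- The heart of the proof is an extension lemma.  Let φ be an algebraic isomorphism onto a
-- coherent configuration X'.  If ρ is a family of points meeting every class and ρ' is a family
-- of points of X' in the same relative position, then ρ ↦ ρ' extends to a combinatorial
-- isomorphism inducing φ: the image of δ must be the unique x with r'(ρ'ᵢ,x) = φ(r(ρᵢ,δ)) for
-- ρᵢ ~ δ, and equality of intersection numbers makes these choices coherent.  With at most three
-- classes, any matching pair (or single point) completes to a matching system of representatives,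
-- one intersection number at a time.  Taking φ = id yields the automorphisms making the scheme
-- schurian; extending a single point yields separability.
module Submission where

open import Defs
open import Data.Nat using (ℕ; zero; suc; _+_; _*_; _≤_; z≤n; s≤s)
open import Data.Nat.Properties using (suc-injective; m≤n⇒m≤1+n; +-suc; +-mono-≤; *-monoʳ-≤;
  +-cancelʳ-≤; n≤0⇒n≡0; +-commutativeSemigroup; module ≤-Reasoning)
open import Algebra.Properties.CommutativeSemigroup +-commutativeSemigroup using (interchange)
open import Data.Nat.Tactic.RingSolver using (solve-∀)
open import Data.Bool using (Bool; true; false; if_then_else_; _∧_; _∨_)
open import Data.Fin using (Fin; zero; suc; _≟_)
open import Data.Fin.Properties using (any?; all?; ¬Fin0)
open import Data.Fin.Subset using (Subset; _∈_; _⊆_)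
open import Data.Fin.Subset.Properties using (_∈?_; anySubset?)
open import Data.Fin.Permutation using (Permutation′; _⟨$⟩ʳ_)
import Data.Fin.Permutation as Permutation
open import Data.Vec using ([]; _∷_; lookup; tabulate)
open import Data.Vec.Properties using (lookup∘tabulate; []=⇒lookup; lookup⇒[]=)
open import Data.Product using (∃-syntax; _×_; _,_; proj₁; proj₂)
open import Data.Sum using (_⊎_; inj₁; inj₂)
open import Data.Empty using (⊥; ⊥-elim)
open import Relation.Nullary using (¬_; Dec; yes; no)
open import Relation.Nullary.Decidable using (⌊_⌋; _×-dec_; _→-dec_; ¬?; map′)
open import Relation.Binary.PropositionalEquality
  using (_≡_; refl; sym; trans; cong; cong₂; subst; module ≡-Reasoning)
open import Function.Bundles using (_↔_; Inverse; mk↔ₛ′; mk⇔)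

⌊⌋-sound : ∀ {A : Set} (d : Dec A) → ⌊ d ⌋ ≡ true → A
⌊⌋-sound (yes a) _ = a
⌊⌋-sound (no _) ()

⌊⌋-complete : ∀ {A : Set} (d : Dec A) → A → ⌊ d ⌋ ≡ true
⌊⌋-complete (yes _) _ = refl
⌊⌋-complete (no ¬a) a = ⊥-elim (¬a a)

∧-true : ∀ {x y} → x ∧ y ≡ true → x ≡ true × y ≡ true
∧-true {true} {true} _ = refl , refl
∧-true {true} {false} ()
∧-true {false} ()

∨-true : ∀ {x y} → x ∨ y ≡ true → x ≡ true ⊎ y ≡ true
∨-true {true} _ = inj₁ refl
∨-true {false} e = inj₂ e

count-witness : ∀ {n} (p : Fin n → Bool) → 1 ≤ count p → ∃[ i ] p i ≡ true
count-witness {zero} p ()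
count-witness {suc n} p h with p zero in eq
... | true = zero , eq
... | false with count-witness (λ i → p (suc i)) h
...   | i , e = suc i , e

count-positive : ∀ {n} (p : Fin n → Bool) (i : Fin n) → p i ≡ true → 1 ≤ count p
count-positive p zero e rewrite e = s≤s z≤n
count-positive p (suc i) e with p zero
... | true = s≤s z≤n
... | false = count-positive (λ j → p (suc j)) i e

count-zero : ∀ {n} (p : Fin n → Bool) → count p ≡ 0 → ∀ i → p i ≡ true → ⊥
count-zero p c i e with () ← subst (1 ≤_) c (count-positive p i e)

count-one : ∀ {n} (p : Fin n → Bool) → count p ≡ 1 → ∀ i j → p i ≡ true → p j ≡ true → i ≡ j
count-one p c zero zero _ _ = refl
count-one p c zero (suc j) pi pj rewrite pi = ⊥-elim (count-zero (λ k → p (suc k)) (suc-injective c) j pj)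
count-one p c (suc i) zero pi pj rewrite pj = ⊥-elim (count-zero (λ k → p (suc k)) (suc-injective c) i pi)
count-one p c (suc i) (suc j) pi pj with p zero
... | true = ⊥-elim (count-zero (λ k → p (suc k)) (suc-injective c) i pi)
... | false = cong suc (count-one (λ k → p (suc k)) c i j pi pj)

count-≤ : ∀ {n} (p : Fin n → Bool) → count p ≤ n
count-≤ {zero} p = z≤n
count-≤ {suc n} p with p zero
... | true = s≤s (count-≤ (λ k → p (suc k)))
... | false = m≤n⇒m≤1+n (count-≤ (λ k → p (suc k)))

Disjoint : ∀ {n} → (Fin n → Bool) → (Fin n → Bool) → Set
Disjoint p q = ∀ i → p i ≡ true → q i ≡ true → ⊥

disjoint-∨ : ∀ {n} {p q r : Fin n → Bool} → Disjoint p r → Disjoint q r → Disjoint (λ i → p i ∨ q i) r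
disjoint-∨ {p = p} {q} pr qr i h with ∨-true {p i} {q i} h
... | inj₁ pi = pr i pi
... | inj₂ qi = qr i qi

count-∨ : ∀ {n} (p q : Fin n → Bool) → Disjoint p q → count (λ i → p i ∨ q i) ≡ count p + count q
count-∨ {zero} p q d = refl
count-∨ {suc n} p q d with p zero in ep | q zero in eq
... | true | true = ⊥-elim (d zero ep eq)
... | true | false = cong suc (count-∨ (λ k → p (suc k)) (λ k → q (suc k)) (λ i → d (suc i)))
... | false | true = trans (cong suc (count-∨ (λ k → p (suc k)) (λ k → q (suc k)) (λ i → d (suc i))))
                           (sym (+-suc (count (λ k → p (suc k))) _))
... | false | false = count-∨ (λ k → p (suc k)) (λ k → q (suc k)) (λ i → d (suc i))

indicator : Bool → ℕ
indicator b = if b then 1 else 0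

sumFin-cong : ∀ {m} {f g : Fin m → ℕ} → (∀ t → f t ≡ g t) → sumFin f ≡ sumFin g
sumFin-cong {zero} h = refl
sumFin-cong {suc m} h = cong₂ _+_ (h zero) (sumFin-cong (λ t → h (suc t)))

sumFin-+ : ∀ {m} (f g : Fin m → ℕ) → sumFin (λ t → f t + g t) ≡ sumFin f + sumFin g
sumFin-+ {zero} f g = refl
sumFin-+ {suc m} f g rewrite sumFin-+ (λ t → f (suc t)) (λ t → g (suc t)) =
  interchange (f zero) (g zero) _ _

sumFin-zero : ∀ {m} (P : Fin m → Bool) → sumFin (λ t → if P t then 0 else 0) ≡ 0
sumFin-zero {zero} P = refl
sumFin-zero {suc m} P with P zero
... | true = sumFin-zero (λ t → P (suc t))
... | false = sumFin-zero (λ t → P (suc t))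

suc-≟ : ∀ {m} (a i : Fin m) → ⌊ Fin.suc a ≟ suc i ⌋ ≡ ⌊ a ≟ i ⌋
suc-≟ a i with a ≟ i
... | yes _ = refl
... | no _ = refl

sumFin-point : ∀ {m} (P : Fin m → Bool) (a : Fin m) →
  sumFin (λ t → if P t then indicator ⌊ a ≟ t ⌋ else 0) ≡ indicator (P a)
sumFin-point {suc m} P zero with P zero
... | true = cong suc (sumFin-zero (λ t → P (suc t)))
... | false = sumFin-zero (λ t → P (suc t))
sumFin-point {suc m} P (suc a) = cong₂ _+_ zero-term (trans shift (sumFin-point (λ t → P (suc t)) a))
  where
  zero-term : (if P zero then 0 else 0) ≡ 0
  zero-term with P zero
  ... | true = refl
  ... | false = refl
  shift : sumFin (λ t → if P (suc t) then indicator ⌊ Fin.suc a ≟ suc t ⌋ else 0)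
        ≡ sumFin (λ t → if P (suc t) then indicator ⌊ a ≟ t ⌋ else 0)
  shift = sumFin-cong (λ t → cong (λ b → if P (suc t) then indicator b else 0) (suc-≟ a t))

if-+ : ∀ b x y → (if b then x + y else 0) ≡ (if b then x else 0) + (if b then y else 0)
if-+ true x y = refl
if-+ false x y = refl

sumFin-fibres : ∀ {n m} (g : Fin n → Fin m) (P : Fin m → Bool) →
  sumFin (λ t → if P t then count (λ β → ⌊ g β ≟ t ⌋) else 0) ≡ count (λ β → P (g β))
sumFin-fibres {zero} g P = sumFin-zero P
sumFin-fibres {suc n} {m} g P = begin
  sumFin (λ t → if P t then head t + tail t else 0)
    ≡⟨ sumFin-cong (λ t → if-+ (P t) (head t) (tail t)) ⟩
  sumFin (λ t → (if P t then head t else 0) + (if P t then tail t else 0))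
    ≡⟨ sumFin-+ (λ t → if P t then head t else 0) (λ t → if P t then tail t else 0) ⟩
  sumFin (λ t → if P t then head t else 0) + sumFin (λ t → if P t then tail t else 0)
    ≡⟨ cong₂ _+_ (sumFin-point P (g zero)) (sumFin-fibres (λ β → g (suc β)) P) ⟩
  indicator (P (g zero)) + count (λ β → P (g (suc β))) ∎
  where
  open ≡-Reasoning
  head tail : Fin m → ℕ
  head t = indicator ⌊ g zero ≟ t ⌋
  tail t = count (λ β → ⌊ g (suc β) ≟ t ⌋)

index-bound : ∀ {n m} (X : CoherentConfiguration n m) (T : Subset m) → IndexAtMost3 X T →
  ∀ α → n ≤ 3 * count (λ β → lookup T (rel X α β))
index-bound {n} X T index α = subst (λ k → n ≤ 3 * k) (sumFin-fibres (rel X α) (lookup T)) (index α)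

four-thirds : ∀ {n} k₁ k₂ k₃ k₄ → k₁ + k₂ + k₃ + k₄ ≤ n →
  n ≤ 3 * k₁ → n ≤ 3 * k₂ → n ≤ 3 * k₃ → n ≤ 3 * k₄ → n ≡ 0
four-thirds {n} k₁ k₂ k₃ k₄ total h₁ h₂ h₃ h₄ =
  n≤0⇒n≡0 (+-cancelʳ-≤ (3 * n) n 0 (begin
    n + 3 * n                          ≡⟨ four-times n ⟩
    n + n + n + n                      ≤⟨ +-mono-≤ (+-mono-≤ (+-mono-≤ h₁ h₂) h₃) h₄ ⟩
    3 * k₁ + 3 * k₂ + 3 * k₃ + 3 * k₄  ≡⟨ distribute k₁ k₂ k₃ k₄ ⟩
    3 * (k₁ + k₂ + k₃ + k₄)            ≤⟨ *-monoʳ-≤ 3 total ⟩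
    3 * n                              ∎))
  where
  open ≤-Reasoning
  four-times : ∀ k → k + 3 * k ≡ k + k + k + k
  four-times = solve-∀
  distribute : ∀ a b c d → 3 * a + 3 * b + 3 * c + 3 * d ≡ 3 * (a + b + c + d)
  distribute = solve-∀

module Paths {n m : ℕ} (X : CoherentConfiguration n m) where

  OnPath : Fin m → Fin m → Fin n → Fin n → Fin n → Bool
  OnPath a b α β γ = ⌊ rel X α γ ≟ a ⌋ ∧ ⌊ rel X γ β ≟ b ⌋

  path-positive : ∀ {a b α β} γ → rel X α γ ≡ a → rel X γ β ≡ b → 1 ≤ inter X a b α β
  path-positive {a} {b} {α} {β} γ e₁ e₂ =
    count-positive (OnPath a b α β) γ
      (cong₂ _∧_ (⌊⌋-complete (rel X α γ ≟ a) e₁) (⌊⌋-complete (rel X γ β ≟ b) e₂))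

  path-witness : ∀ {a b α β} → 1 ≤ inter X a b α β → ∃[ γ ] rel X α γ ≡ a × rel X γ β ≡ b
  path-witness {a} {b} {α} {β} h with count-witness (OnPath a b α β) h
  ... | γ , e with ∧-true {⌊ rel X α γ ≟ a ⌋} e
  ...   | e₁ , e₂ = γ , ⌊⌋-sound (rel X α γ ≟ a) e₁ , ⌊⌋-sound (rel X γ β ≟ b) e₂

  transpose-cong : ∀ {α β γ δ} → rel X α β ≡ rel X γ δ → rel X β α ≡ rel X δ γ
  transpose-cong {α} {β} {γ} {δ} e with transposeClosed X (rel X α β)
  ... | _ , star , _ = trans (star α β refl) (sym (star γ δ (sym e)))

  out-neighbour : (∀ α β → rel X α α ≡ rel X β β) → ∀ α s → ∃[ β ] rel X α β ≡ s
  out-neighbour homogeneous α s with nonempty X s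
  ... | p , q , e with path-witness (subst (1 ≤_)
                         (regular X s (rel X q p) p p α α (homogeneous p α)) (path-positive q e refl))
  ...   | β , e₁ , _ = β , e₁

-- Transport along an algebraic isomorphism φ from an association scheme X to a coherent
-- configuration X': equal intersection numbers let paths be carried over in both directions.
module Transport {n m n' m' : ℕ} (X : CoherentConfiguration n m)
  (homogeneous : ∀ α β → rel X α α ≡ rel X β β)
  (X' : CoherentConfiguration n' m') (φ : Fin m ↔ Fin m') (iso : IsAlgIso X X' φ) where

  private
    module P = Paths X
    module P' = Paths X'

  φ⁺ : Fin m → Fin m'
  φ⁺ = Inverse.to φ

  φ⁻ : Fin m' → Fin m
  φ⁻ = Inverse.from φ

  φ⁺-injective : ∀ {a b} → φ⁺ a ≡ φ⁺ b → a ≡ b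
  φ⁺-injective {a} {b} e =
    trans (sym (Inverse.strictlyInverseʳ φ a)) (trans (cong φ⁻ e) (Inverse.strictlyInverseʳ φ b))

  from-preimage : ∀ {a y} → a ≡ φ⁻ y → y ≡ φ⁺ a
  from-preimage {a} {y} e = sym (trans (cong φ⁺ e) (Inverse.strictlyInverseˡ φ y))

  Corr : Fin n → Fin n → Fin n' → Fin n' → Set
  Corr α β α' β' = rel X' α' β' ≡ φ⁺ (rel X α β)

  transfer : ∀ {α β α' β'} → Corr α β α' β' → ∀ γ → ∃[ γ' ] Corr α γ α' γ' × Corr γ β γ' β'
  transfer {α} {β} {α'} {β'} e γ =
    P'.path-witness (subst (1 ≤_) (iso (rel X α γ) (rel X γ β) α β α' β' e) (P.path-positive γ refl refl))

  reflect : ∀ {α β α' β'} → Corr α β α' β' → ∀ γ' → ∃[ γ ] Corr α γ α' γ' × Corr γ β γ' β'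
  reflect {α} {β} {α'} {β'} e γ'
    with P.path-witness (subst (1 ≤_) (sym (iso (φ⁻ (rel X' α' γ')) (φ⁻ (rel X' γ' β')) α β α' β' e))
           (P'.path-positive γ' (from-preimage refl) (from-preimage refl)))
  ... | γ , e₁ , e₂ = γ , from-preimage e₁ , from-preimage e₂

  diagonal : ∀ x α → Corr α α x x
  diagonal x α with nonempty X (φ⁻ (rel X' x x))
  ... | p , q , e with transfer {p} {q} {x} {x} (from-preimage e) q
  ...   | γ' , e₁ , e₂ = begin
    rel X' x x     ≡⟨ cong (λ z → rel X' z x) (diagUnion X' x x γ' (trans (from-preimage e) (sym e₁))) ⟩
    rel X' γ' x    ≡⟨ e₂ ⟩
    φ⁺ (rel X q q) ≡⟨ cong φ⁺ (homogeneous q α) ⟩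
    φ⁺ (rel X α α) ∎
    where open ≡-Reasoning

  corr-diagonal-target : ∀ {α x y} → Corr α α x y → x ≡ y
  corr-diagonal-target {α} {x} {y} e = diagUnion X' x x y (trans (diagonal x α) (sym e))

  corr-diagonal-source : ∀ {α β x} → Corr α β x x → α ≡ β
  corr-diagonal-source {α} {β} {x} e = diagUnion X α α β (φ⁺-injective (trans (sym (diagonal x α)) e))

  transpose : ∀ {α β α' β'} → Corr α β α' β' → Corr β α β' α'
  transpose {α} {β} {α'} {β'} e with transfer (diagonal α' α) β
  ... | γ' , e₁ , e₂ = trans (P'.transpose-cong (trans e (sym e₁))) e₂

  image-exists : ∀ α β α' → ∃[ β' ] Corr α β α' β'
  image-exists α β α' with transfer (diagonal α' α) β
  ... | β' , e , _ = β' , e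

record ThinClosed {n m : ℕ} (X : CoherentConfiguration n m) (R : Subset m) : Set where
  field
    contains-ss* : ∀ α β γ → rel X α γ ≡ rel X β γ → rel X α β ∈ R
    closed       : ∀ α β γ → rel X α γ ∈ R → rel X β γ ∈ R → rel X α β ∈ R
    thin         : ∀ t → t ∈ R → Thin X t

thin-closed : ∀ {n m} {X : CoherentConfiguration n m} {R : Subset m} →
  IsThinResidue X R → (∀ t → t ∈ R → Thin X t) → ThinClosed X R
thin-closed {X = X} ((_ , closed) , contains-ss* , _) thin = record
  { contains-ss* = λ α β γ e → contains-ss* (rel X α γ) (rel X α β) (α , β , γ , refl , refl , sym e)
  ; closed       = λ α β γ h₁ h₂ → closed (rel X α γ) (rel X β γ) (rel X α β) h₁ h₂
                                     (α , β , γ , refl , refl , refl)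
  ; thin         = thin
  }

module Classes {n m : ℕ} {X : CoherentConfiguration n m} {R : Subset m} (tc : ThinClosed X R) where
  open ThinClosed tc
  open Paths X using (transpose-cong)

  -- ~ is an equivalence relation: reflexive since 1 ∈ s s*, symmetric and transitive by closure.
  _~_ : Fin n → Fin n → Set
  α ~ β = rel X α β ∈ R

  _~?_ : ∀ α β → Dec (α ~ β)
  α ~? β = rel X α β ∈? R

  ~-refl : ∀ α → α ~ α
  ~-refl α = contains-ss* α α α refl

  ~-sym : ∀ {α β} → α ~ β → β ~ α
  ~-sym {α} {β} h = closed β α β (~-refl β) h

  ~-trans : ∀ {α β γ} → α ~ β → β ~ γ → α ~ γ
  ~-trans {α} {β} {γ} h₁ h₂ = closed α γ β h₁ (~-sym h₂)

  thin-unique : ∀ {t α β β'} → t ∈ R → rel X α β ≡ t → rel X α β' ≡ t → β ≡ β'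
  thin-unique {t} {α} {β} {β'} t∈R e₁ e₂ =
    count-one (λ γ → ⌊ rel X α γ ≟ t ⌋) (thin t t∈R α) β β'
      (⌊⌋-complete (rel X α β ≟ t) e₁) (⌊⌋-complete (rel X α β' ≟ t) e₂)

  same-relation : ∀ {α β γ} → rel X α β ≡ rel X α γ → β ~ γ
  same-relation {α} {β} {γ} e = contains-ss* β γ α (transpose-cong e)

  class : Fin n → Fin n → Bool
  class α β = lookup R (rel X α β)

  classes-disjoint : ∀ {α β} → ¬ α ~ β → Disjoint (class α) (class β)
  classes-disjoint α≁β δ h₁ h₂ = α≁β (~-trans (lookup⇒[]= _ R h₁) (~-sym (lookup⇒[]= _ R h₂)))

  -- ρ is a system of representatives (possibly with repetitions): it meets every class.
  Meets : ∀ {k} → (Fin k → Fin n) → Set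
  Meets ρ = ∀ δ → ∃[ i ] ρ i ~ δ

  triple : ∀ {A : Set} → A → A → A → Fin 3 → A
  triple a b c = lookup (a ∷ b ∷ c ∷ [])

  module AtMostThree (index : ∀ α → n ≤ 3 * count (class α)) where

    -- Four pairwise inequivalent points would have four disjoint classes of size ≥ n/3.
    no-four : ∀ {a b c d} → ¬ a ~ b → ¬ a ~ c → ¬ a ~ d → ¬ b ~ c → ¬ b ~ d → ¬ c ~ d → ⊥
    no-four {a} {b} {c} {d} a≁b a≁c a≁d b≁c b≁d c≁d =
      ¬Fin0 (subst Fin (four-thirds (count (class a)) (count (class b)) (count (class c)) (count (class d))
                        total (index a) (index b) (index c) (index d)) a)
      where
      open ≡-Reasoning
      union : Fin n → Bool
      union β = ((class a β ∨ class b β) ∨ class c β) ∨ class d β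
      sizes : count union ≡ count (class a) + count (class b) + count (class c) + count (class d)
      sizes = begin
        count union
          ≡⟨ count-∨ _ (class d) (disjoint-∨ (disjoint-∨ (classes-disjoint a≁d) (classes-disjoint b≁d))
                                              (classes-disjoint c≁d)) ⟩
        count (λ β → (class a β ∨ class b β) ∨ class c β) + count (class d)
          ≡⟨ cong (_+ count (class d))
               (count-∨ _ (class c) (disjoint-∨ (classes-disjoint a≁c) (classes-disjoint b≁c))) ⟩
        count (λ β → class a β ∨ class b β) + count (class c) + count (class d)
          ≡⟨ cong (λ k → k + count (class c) + count (class d)) (count-∨ (class a) (class b)
               (classes-disjoint a≁b)) ⟩
        count (class a) + count (class b) + count (class c) + count (class d) ∎
      total : count (class a) + count (class b) + count (class c) + count (class d) ≤ n
      total = subst (_≤ n) sizes (count-≤ union)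

    third-representative : ∀ a b → ¬ a ~ b → ∃[ c ] Meets (triple a b c)
    third-representative a b a≁b with any? (λ c → ¬? (a ~? c) ×-dec ¬? (b ~? c))
    ... | yes (c , a≁c , b≁c) = c , meets
      where
      meets : Meets (triple a b c)
      meets δ with a ~? δ | b ~? δ | c ~? δ
      ... | yes a~δ | _ | _ = zero , a~δ
      ... | no _ | yes b~δ | _ = suc zero , b~δ
      ... | no _ | no _ | yes c~δ = suc (suc zero) , c~δ
      ... | no a≁δ | no b≁δ | no c≁δ = ⊥-elim (no-four a≁b a≁c a≁δ b≁c b≁δ c≁δ)
    ... | no none = a , meets
      where
      meets : Meets (triple a b a)
      meets δ with a ~? δ | b ~? δ
      ... | yes a~δ | _ = zero , a~δ
      ... | no _ | yes b~δ = suc zero , b~δ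
      ... | no a≁δ | no b≁δ = ⊥-elim (none (δ , a≁δ , b≁δ))

    single-class-or-outsider : ∀ a → Meets {1} (λ _ → a) ⊎ ∃[ b ] ¬ a ~ b
    single-class-or-outsider a with any? (λ b → ¬? (a ~? b))
    ... | yes outsider = inj₂ outsider
    ... | no none = inj₁ meets
      where
      meets : Meets {1} (λ _ → a)
      meets δ with a ~? δ
      ... | yes a~δ = zero , a~δ
      ... | no a≁δ = ⊥-elim (none (δ , a≁δ))

module Extension {n m n' m' : ℕ} (X : CoherentConfiguration n m)
  (homogeneous : ∀ α β → rel X α α ≡ rel X β β) {R : Subset m} (tc : ThinClosed X R)
  (X' : CoherentConfiguration n' m') (φ : Fin m ↔ Fin m') (iso : IsAlgIso X X' φ) where

  open Paths X using (out-neighbour)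
  open Classes tc
  open Transport X homogeneous X' φ iso

  image-unique : ∀ {α β α' x y} → α ~ β → Corr α β α' x → Corr α β α' y → x ≡ y
  image-unique {α} {β} {α'} {x} {y} α~β ex ey with reflect ex y
  ... | γ , eαγ , eγβ = sym (corr-diagonal-target (subst (λ z → Corr z β y x) γ≡β eγβ))
    where
    γ≡β : γ ≡ β
    γ≡β = thin-unique α~β (φ⁺-injective (trans (sym eαγ) ey)) refl

  Matching : ∀ {k} → (Fin k → Fin n) → (Fin k → Fin n') → Set
  Matching ρ ρ' = ∀ i j → Corr (ρ i) (ρ j) (ρ' i) (ρ' j)

  Induces : Fin n ↔ Fin n' → Set
  Induces F = ∀ δ ε → Corr δ ε (Inverse.to F δ) (Inverse.to F ε)

  module Representatives {k} (ρ : Fin (suc k) → Fin n) (ρ' : Fin (suc k) → Fin n')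
    (meets : Meets ρ) (matching : Matching ρ ρ') where

    rep : Fin n → Fin (suc k)
    rep δ = proj₁ (meets δ)

    rep~ : ∀ δ → ρ (rep δ) ~ δ
    rep~ δ = proj₂ (meets δ)

    f : Fin n → Fin n'
    f δ = proj₁ (image-exists (ρ (rep δ)) δ (ρ' (rep δ)))

    f-rep : ∀ δ → Corr (ρ (rep δ)) δ (ρ' (rep δ)) (f δ)
    f-rep δ = proj₂ (image-exists (ρ (rep δ)) δ (ρ' (rep δ)))

    f-from : ∀ i ε → Corr (ρ i) ε (ρ' i) (f ε)
    f-from i ε with transfer (matching i (rep ε)) ε
    ... | γ' , e₁ , e₂ =
      subst (Corr (ρ i) ε (ρ' i)) (image-unique (rep~ ε) (transpose e₂) (f-rep ε)) e₁

    f-induces : ∀ δ ε → Corr δ ε (f δ) (f ε)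
    f-induces δ ε =
      let γ' , e₁ , e₂ = transfer (f-from (rep δ) ε) δ
      in subst (λ z → Corr δ ε z (f ε)) (image-unique (rep~ δ) e₁ (f-rep δ)) e₂

    f-injective : ∀ {δ ε} → f δ ≡ f ε → δ ≡ ε
    f-injective {δ} {ε} e = corr-diagonal-source (subst (Corr δ ε (f δ)) (sym e) (f-induces δ ε))

    -- A preimage of x: reach x from ρ'₀ through some δ, move to the representative ρᵢ of δ,
    -- and find the point seen from ρᵢ as x is seen from ρ'ᵢ.
    f-surjective : ∀ x → ∃[ δ ] f δ ≡ x
    f-surjective x =
      let δ , e₀ , _ = reflect (diagonal (ρ' zero) (ρ zero)) x
          i = rep δ
          γ , e₁ , e₂ = reflect e₀ (ρ' i)
          γ~δ : γ ~ δ
          γ~δ = ~-trans (same-relation (φ⁺-injective (trans (sym e₁) (matching zero i)))) (rep~ δ)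
          δ₂ , e₃ = out-neighbour homogeneous (ρ i) (rel X γ δ)
          ρᵢ~δ₂ : ρ i ~ δ₂
          ρᵢ~δ₂ = subst (_∈ R) (sym e₃) γ~δ
      in δ₂ , image-unique ρᵢ~δ₂ (f-from i δ₂) (trans e₂ (cong φ⁺ (sym e₃)))

    F : Fin n ↔ Fin n'
    F = mk↔ₛ′ f (λ x → proj₁ (f-surjective x)) (λ x → proj₂ (f-surjective x))
              (λ δ → f-injective (proj₂ (f-surjective (f δ))))

  extend-representatives : ∀ {k} (ρ : Fin (suc k) → Fin n) (ρ' : Fin (suc k) → Fin n') →
    Meets ρ → Matching ρ ρ' → ∃[ F ] Induces F × (∀ i → Inverse.to F (ρ i) ≡ ρ' i)
  extend-representatives ρ ρ' meets matching =
    F , f-induces , λ i → sym (corr-diagonal-target (f-from i (ρ i)))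
    where open Representatives ρ ρ' meets matching

  -- A matching pair extends to a matching triple by one path transfer.
  matching-triple : ∀ {a b a' b'} → Corr a b a' b' → ∀ c → ∃[ c' ] Matching (triple a b c) (triple a' b' c')
  matching-triple {a} {b} {a'} {b'} e c with transfer e c
  ... | c' , e₁ , e₂ = c' , matching
    where
    matching : Matching (triple a b c) (triple a' b' c')
    matching zero zero = diagonal a' a
    matching zero (suc zero) = e
    matching zero (suc (suc zero)) = e₁
    matching (suc zero) zero = transpose e
    matching (suc zero) (suc zero) = diagonal b' b
    matching (suc zero) (suc (suc zero)) = transpose e₂
    matching (suc (suc zero)) zero = transpose e₁
    matching (suc (suc zero)) (suc zero) = e₂
    matching (suc (suc zero)) (suc (suc zero)) = diagonal c' c

  module AtMostThreeClasses (index : ∀ α → n ≤ 3 * count (class α)) where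
    open AtMostThree index

    extend-inequivalent : ∀ {a b a' b'} → ¬ a ~ b → Corr a b a' b' →
      ∃[ F ] Induces F × Inverse.to F a ≡ a' × Inverse.to F b ≡ b'
    extend-inequivalent {a} {b} {a'} {b'} a≁b e =
      let c , meets = third-representative a b a≁b
          c' , matching = matching-triple e c
          F , induces , fixes = extend-representatives (triple a b c) (triple a' b' c') meets matching
      in F , induces , fixes zero , fixes (suc zero)

    extend-point : ∀ a a' → ∃[ F ] Induces F × Inverse.to F a ≡ a'
    extend-point a a' with single-class-or-outsider a
    ... | inj₁ meets =
      let F , induces , fixes = extend-representatives (λ _ → a) (λ _ → a') meets (λ _ _ → diagonal a' a)
      in F , induces , fixes zero
    ... | inj₂ (b , a≁b) =
      let b' , e = image-exists a b a'
          F , induces , fixes-a , _ = extend-inequivalent a≁b e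
      in F , induces , fixes-a

    -- Every matching pair extends; for equivalent points the second image is forced.
    extend-pair : ∀ {a b a' b'} → Corr a b a' b' →
      ∃[ F ] Induces F × Inverse.to F a ≡ a' × Inverse.to F b ≡ b'
    extend-pair {a} {b} {a'} e with a ~? b
    ... | no a≁b = extend-inequivalent a≁b e
    ... | yes a~b =
      let F , induces , fixes-a = extend-point a a'
          fixes-b = image-unique a~b (subst (λ z → Corr a b z (Inverse.to F b)) fixes-a (induces a b)) e
      in F , induces , fixes-a , fixes-b

IsAutomorphism : ∀ {n m} → CoherentConfiguration n m → Permutation′ n → Set
IsAutomorphism X g = ∀ α β → rel X (g ⟨$⟩ʳ α) (g ⟨$⟩ʳ β) ≡ rel X α β

automorphism-group : ∀ {n m} (X : CoherentConfiguration n m) → IsPermGroup (IsAutomorphism X)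
automorphism-group X = record
  { hasId  = Permutation.id , (λ α β → refl) , (λ α → refl)
  ; compCl = λ g h g-aut h-aut α β → trans (h-aut _ _) (g-aut α β)
  ; invCl  = λ g g-aut α β → trans (sym (g-aut _ _))
                               (cong₂ (rel X) (Inverse.strictlyInverseˡ g α) (Inverse.strictlyInverseˡ g β))
  }

schurian-if-transitive : ∀ {n m} (X : CoherentConfiguration n m) →
  (∀ α β α' β' → rel X α β ≡ rel X α' β' →
    ∃[ g ] IsAutomorphism X g × g ⟨$⟩ʳ α ≡ α' × g ⟨$⟩ʳ β ≡ β') → Schurian X
schurian-if-transitive X transitive =
  IsAutomorphism X , automorphism-group X , λ α β α' β' → mk⇔ (transitive α β α' β') (preserved α β α' β')
  where
  preserved : ∀ α β α' β' → ∃[ g ] IsAutomorphism X g × g ⟨$⟩ʳ α ≡ α' × g ⟨$⟩ʳ β ≡ β' →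
    rel X α β ≡ rel X α' β'
  preserved α β α' β' (g , g-aut , e₁ , e₂) = trans (sym (g-aut α β)) (cong₂ (rel X) e₁ e₂)

identity-algebraic : ∀ {n m} (X : CoherentConfiguration n m) → IsAlgIso X X Permutation.id
identity-algebraic X r s α β α' β' e = regular X r s α β α' β' (sym e)

-- The thin residue exists (on a nonempty set): it is the intersection of all closed subsets
-- containing every s s*, which is computable since everything is finite.
module ThinResidue {n m : ℕ} (X : CoherentConfiguration n m) where

  Admissible : Subset m → Set
  Admissible T = Closed X T × ContainsAllSS* X T

  in-prod-star? : ∀ r s t → Dec (InProdStar X r s t)
  in-prod-star? r s t = any? λ α → any? λ β → any? λ γ →
    (rel X α β ≟ t) ×-dec ((rel X α γ ≟ r) ×-dec (rel X β γ ≟ s))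

  admissible? : ∀ T → Dec (Admissible T)
  admissible? T = (any? (_∈? T) ×-dec closure?) ×-dec contains-ss*?
    where
    closure? : Dec (∀ r s t → r ∈ T → s ∈ T → InProdStar X r s t → t ∈ T)
    closure? = all? λ r → all? λ s → all? λ t →
      (r ∈? T) →-dec ((s ∈? T) →-dec (in-prod-star? r s t →-dec (t ∈? T)))
    contains-ss*? : Dec (ContainsAllSS* X T)
    contains-ss*? = all? λ s → all? λ t → in-prod-star? s s t →-dec (t ∈? T)

  in-all? : ∀ t → Dec (∀ T → Admissible T → t ∈ T)
  in-all? t = map′ from-none to-none (¬? (anySubset? λ T → admissible? T ×-dec ¬? (t ∈? T)))
    where
    from-none : ¬ (∃[ T ] Admissible T × ¬ t ∈ T) → ∀ T → Admissible T → t ∈ T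
    from-none none T adm with t ∈? T
    ... | yes t∈T = t∈T
    ... | no t∉T = ⊥-elim (none (T , adm , t∉T))
    to-none : (∀ T → Admissible T → t ∈ T) → ¬ (∃[ T ] Admissible T × ¬ t ∈ T)
    to-none in-every (T , adm , t∉T) = t∉T (in-every T adm)

  residue : Subset m
  residue = tabulate (λ t → ⌊ in-all? t ⌋)

  residue-⊆ : ∀ {t} → t ∈ residue → ∀ T → Admissible T → t ∈ T
  residue-⊆ {t} h = ⌊⌋-sound (in-all? t) (trans (sym (lookup∘tabulate _ t)) ([]=⇒lookup h))

  ⊆-residue : ∀ {t} → (∀ T → Admissible T → t ∈ T) → t ∈ residue
  ⊆-residue {t} h = lookup⇒[]= t residue (trans (lookup∘tabulate _ t) (⌊⌋-complete (in-all? t) h))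

  thin-residue : Fin n → IsThinResidue X residue
  thin-residue α = (nonempty-residue , closed-residue) , contains-residue , least
    where
    nonempty-residue : ∃[ t ] t ∈ residue
    nonempty-residue = rel X α α , ⊆-residue λ T adm → proj₂ adm _ _ (α , α , α , refl , refl , refl)
    closed-residue : ∀ r s t → r ∈ residue → s ∈ residue → InProdStar X r s t → t ∈ residue
    closed-residue r s t hr hs p =
      ⊆-residue λ T adm → proj₂ (proj₁ adm) r s t (residue-⊆ hr T adm) (residue-⊆ hs T adm) p
    contains-residue : ContainsAllSS* X residue
    contains-residue s t p = ⊆-residue λ T adm → proj₂ adm s t p
    least : ∀ T → Closed X T → ContainsAllSS* X T → residue ⊆ T
    least T closed contains h = residue-⊆ h T (closed , contains)

-- A scheme on the empty set has no basis relations, so both properties hold vacuously.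
empty-scheme : ∀ {m} (A : AssociationScheme 0 m) → Schurian (cc A) × Separable (cc A)
empty-scheme {m} A = schurian-if-transitive (cc A) (λ ()) , separable
  where
  no-relation : Fin m → ⊥
  no-relation s with nonempty (cc A) s
  ... | () , _
  separable : Separable (cc A)
  separable n' m' X' φ _ =
    mk↔ₛ′ (λ ()) (λ x → ⊥-elim (no-point x)) (λ x → ⊥-elim (no-point x)) (λ ()) , λ ()
    where
    no-point : Fin n' → ⊥
    no-point x = no-relation (Inverse.from φ (rel X' x x))

corollary1p4 : ∀ {n m : ℕ} (A : AssociationScheme n m) → MetaThin A → ThinResidueIndexAtMost3 A
    → Schurian (cc A) × Separable (cc A)
corollary1p4 {zero} A _ _ = empty-scheme A
corollary1p4 {suc k} {m} A meta-thin index = schurian-if-transitive X transitive , separable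
  where
  X : CoherentConfiguration (suc k) m
  X = cc A
  open ThinResidue X using (residue; thin-residue)

  is-residue : IsThinResidue X residue
  is-residue = thin-residue zero

  tc : ThinClosed X residue
  tc = thin-closed is-residue (meta-thin residue is-residue)

  classes≤3 : ∀ α → suc k ≤ 3 * count (λ β → lookup residue (rel X α β))
  classes≤3 = index-bound X residue (index residue is-residue)

  module Ext {n' m'} (X' : CoherentConfiguration n' m') (φ : Fin m ↔ Fin m') (iso : IsAlgIso X X' φ) =
    Extension.AtMostThreeClasses X (diagBasis A) tc X' φ iso classes≤3

  -- Automorphisms are the isomorphisms from X to itself inducing the identity.
  transitive : ∀ α β α' β' → rel X α β ≡ rel X α' β' →
    ∃[ g ] IsAutomorphism X g × g ⟨$⟩ʳ α ≡ α' × g ⟨$⟩ʳ β ≡ β'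
  transitive α β α' β' e = Ext.extend-pair X Permutation.id (identity-algebraic X) (sym e)

  separable : Separable X
  separable n' m' X' φ iso =
    let x₀ = proj₁ (nonempty X' (Inverse.to φ (rel X zero zero)))
        F , induces , _ = Ext.extend-point X' φ iso zero x₀
    in F , induces
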